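{- Let $q\ge2$ be an integer. A $q$-canonical configuration is not $(q-1)$-monotone (i.e. it is at most $(q-2)$-monotone).
   Context: $T_j=j(j+1)/2$. A mancala configuration is $\lambda:\mathbb N^*\to\mathbb N$ with support $\{1,\dots,\ell(\lambda)\}$; mass $|\lambda|=\sum\lambda_i$. Move $\Phi$: $\mu=\Phi(\lambda)$, $\mu_i=\lambda_{i+1}+1$ for $1\le i\le\lambda_1$, $\mu_i=\lambda_{i+1}$ for $i>\lambda_1$. Marching group $M^k_i=k-i+1$ ($i\le k$), $0$ otherwise; order is componentwise. Energy sequence: with $m=\max\{\lambda_1,\ell(\lambda)\}$, $e_i=\lambda_i+i-1$ for $1\le i\le m$, extended $m$-periodically to $\mathbb Z$. For $s\ge1$, $\lambda$ is $s$-monotone if $\lambda_1\le\ell(\lambda)+1$ and $e_j\le e_i+1$ for all integers $i<j\le i+s$. Energy-level picture: $\lambda$ is identified with the set of occupied cells $\{(i,j): i\ge1,\ i\le j\le\lambda_i+i-1\}$ in $\{(i,j)\in\mathbb N^*\times\mathbb N^*: i\le j\}$; level $j$ consists of the cells $(1,j),\dots,(j,j)$. If $\lambda\ge M^{q-1}$ but not $\lambda\ge M^q$, the empty cells of level $q$ are called gaps. A gap in column $c$ of $\lambda$ is tracked through moves as rotating left along level $q$: at time $t$ its position is column $c_t\in\{1,\dots,q\}$ with $c_t\equiv c-t\pmod q$; it is filled at the first time $t\ge1$ at which cell $(c_t,q)$ is occupied in $\Phi^t(\lambda)$ (filling is permanent, and if $|\lambda|\ge T_q$ all gaps are eventually filled,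 one at a time). For $q\ge2$, $\lambda$ with $|\lambda|\ge T_q$ is $q$-canonical if: (1) $\lambda\ge M^{q-1}$; (2) $\ell(\lambda)=q-1$; (3) the gap in column $q$ of level $q$ is the last gap of level $q$ to be filled. -}

module Defs where

open import Data.Nat using (ℕ; zero; suc; _+_; _*_; _∸_; _≤_; _<_; _⊔_; _/_; _%_)
open import Data.Integer as ℤ using (ℤ; +_; _%ℕ_)
open import Data.List using (List; []; _∷_; length)
open import Data.Nat.ListAction using (sum)
open import Data.List.Relation.Unary.All using (All)
open import Data.Product using (Σ; _×_; ∃)
open import Relation.Nullary using (¬_)
open import Relation.Binary.PropositionalEquality using (_≡_)

T : ℕ → ℕ
T j = (j * suc j) / 2

-- A mancala configuration is represented by the finite list
-- (λ_1, …, λ_ℓ) of its values on its support {1,…,ℓ}; all entries are ≥ 1.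
Config : List ℕ → Set
Config λs = All (λ x → 1 ≤ x) λs

-- λ_i (1-based), with λ_i = 0 outside {1,…,ℓ(λ)} (and for i = 0).
get : List ℕ → ℕ → ℕ
get _        zero          = 0
get []       (suc _)       = 0
get (x ∷ xs) (suc zero)    = x
get (x ∷ xs) (suc (suc n)) = get xs (suc n)

ℓ : List ℕ → ℕ
ℓ = length

mass : List ℕ → ℕ
mass = sum

addOnes : ℕ → List ℕ → List ℕ
addOnes zero    xs       = xs
addOnes (suc n) []       = 1 ∷ addOnes n []
addOnes (suc n) (x ∷ xs) = suc x ∷ addOnes n xs

-- The move Φ: μ_i = λ_{i+1} + 1 for 1 ≤ i ≤ λ_1, μ_i = λ_{i+1} for i > λ_1.
Φ : List ℕ → List ℕ
Φ []       = []
Φ (x ∷ xs) = addOnes x xs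

Φ^ : ℕ → List ℕ → List ℕ
Φ^ zero    λs = λs
Φ^ (suc t) λs = Φ (Φ^ t λs)

M : ℕ → ℕ → ℕ
M k zero    = 0
M k (suc i) = k ∸ i

_≥M_ : List ℕ → ℕ → Set
λs ≥M k = ∀ (i : ℕ) → M k i ≤ get λs i

period : List ℕ → ℕ
period λs = get λs 1 ⊔ ℓ λs

-- Energy sequence e : ℤ → ℕ, e_i = λ_i + i - 1 for 1 ≤ i ≤ m, m-periodic.
-- For index i, r = (i - 1) mod m ∈ {0,…,m-1} and e_i = λ_{r+1} + r.
-- (The case m = 0, i.e. the empty configuration, is irrelevant; we put e = 0.)
energyAux : List ℕ → ℕ → ℤ → ℕ
energyAux λs zero     i = 0
energyAux λs (suc m') i =
  let r = (i ℤ.- ℤ.+ 1) %ℕ suc m' in get λs (suc r) + r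

energy : List ℕ → ℤ → ℕ
energy λs = energyAux λs (period λs)

-- s-monotone: λ_1 ≤ ℓ(λ) + 1 and e_j ≤ e_i + 1 for all integers i < j ≤ i + s
-- (j written as i + k with 1 ≤ k ≤ s).
Monotone : ℕ → List ℕ → Set
Monotone s λs =
  (get λs 1 ≤ suc (ℓ λs)) ×
  (∀ (i : ℤ) (k : ℕ) → 1 ≤ k → k ≤ s →
     energy λs (i ℤ.+ ℤ.+ k) ≤ suc (energy λs i))

Occupied : List ℕ → ℕ → ℕ → Set
Occupied λs c j = (1 ≤ c) × (c ≤ j) × (j < get λs c + c)

Gap : ℕ → List ℕ → ℕ → Set
Gap q λs c = (1 ≤ c) × (c ≤ q) × ¬ Occupied λs c q

-- Position at time t of the gap starting in column c of level q:
-- c_t ∈ {1,…,q}, c_t ≡ c - t (mod q).  Computed as 1 + ((c - 1 + (q-1) t) mod q)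
-- (here suc (q ∸ 1) = q since q ≥ 1 in all uses).
gapCol : ℕ → ℕ → ℕ → ℕ
gapCol q c t = suc ((c ∸ 1 + (q ∸ 1) * t) % suc (q ∸ 1))

FilledAt : ℕ → List ℕ → ℕ → ℕ → Set
FilledAt q λs c t =
  (1 ≤ t) × Occupied (Φ^ t λs) (gapCol q c t) q ×
  (∀ t' → 1 ≤ t' → t' < t → ¬ Occupied (Φ^ t' λs) (gapCol q c t') q)

Canonical : ℕ → List ℕ → Set
Canonical q λs =
  (T q ≤ mass λs) ×
  (λs ≥M (q ∸ 1)) ×
  (ℓ λs ≡ q ∸ 1) ×
  (Gap q λs q ×
   Σ ℕ (λ tq → FilledAt q λs q tq ×
      (∀ c t → Gap q λs c → FilledAt q λs c t → t ≤ tq)))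

-- Only the mass and length clauses of canonicity matter.  If ℓ(λ) = n + 1 and λ is
-- (n + 1)-monotone, then the energy period m is n + 1 or n + 2, and comparing every
-- e_i (1 ≤ i ≤ n + 1) with e_1 (when m = n + 1) or with e_0 = e_m = n + 1 (when
-- m = n + 2) gives λ_i + i ≤ n + 3.  Summing these bounds,
-- |λ| ≤ Σ_{i=1}^{n+1} (n + 3 - i) = T_{n+2} - 1, against |λ| ≥ T_q for q = n + 2.
module Submission where

open import Defs
open import Data.Nat using (ℕ; _≤_; _∸_)
open import Data.List using (List)
open import Relation.Nullary using (¬_)

open import Data.Nat using (zero; suc; _+_; _*_; _<_; _⊔_; z≤n; s≤s; _≤?_)
open import Data.Nat.Properties
open import Data.Nat.DivMod using (_/_; /-monoˡ-≤; m*n/n≡m; m<n⇒m%n≡m)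
open import Data.Nat.ListAction using (sum)
open import Data.Nat.Tactic.RingSolver using (solve-∀)
open import Data.Integer using (+_)
open import Data.List using ([]; _∷_; length)
open import Data.Product using (_,_; proj₁; proj₂)
open import Relation.Nullary using (yes; no)
open import Relation.Binary.PropositionalEquality

m*2≤n⇒m≤n/2 : ∀ {m n} → m * 2 ≤ n → m ≤ n / 2
m*2≤n⇒m≤n/2 {m} {n} m*2≤n = begin
  m         ≡⟨ m*n/n≡m m 2 ⟨
  m * 2 / 2 ≤⟨ /-monoˡ-≤ 2 m*2≤n ⟩
  n / 2     ∎
  where open ≤-Reasoning

length<⇒get≡0 : ∀ xs i → length xs < i → get xs i ≡ 0
length<⇒get≡0 xs       zero          ()
length<⇒get≡0 []       (suc i)       _         = refl
length<⇒get≡0 (x ∷ xs) (suc zero)    (s≤s ())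
length<⇒get≡0 (x ∷ xs) (suc (suc i)) (s≤s len<) = length<⇒get≡0 xs (suc i) len<

-- The offset a makes the statement inductive: passing to the tail shifts indices by one.
sum+staircase≤ : ∀ xs a b → (∀ i → 1 ≤ i → i ≤ length xs → get xs i + i + a ≤ b) →
  2 * sum xs + length xs * suc (length xs) + 2 * length xs * a ≤ 2 * length xs * b
sum+staircase≤ []       a b bound = z≤n
sum+staircase≤ (x ∷ xs) a b bound =
  subst₂ _≤_ (sym (regroup x (sum xs) (length xs) a)) (sym (split (length xs) b))
    (+-mono-≤ (sum+staircase≤ xs (suc a) b shifted) (*-monoʳ-≤ 2 (bound 1 (s≤s z≤n) (s≤s z≤n))))
  where
  regroup : ∀ x s n a → 2 * (x + s) + suc n * suc (suc n) + 2 * suc n * a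
                      ≡ (2 * s + n * suc n + 2 * n * suc a) + 2 * (x + 1 + a)
  regroup = solve-∀
  split : ∀ n b → 2 * suc n * b ≡ 2 * n * b + 2 * b
  split = solve-∀
  shift : ∀ g i a → g + suc i + a ≡ g + i + suc a
  shift = solve-∀
  shifted : ∀ i → 1 ≤ i → i ≤ length xs → get xs i + i + suc a ≤ b
  shifted (suc i) _ i≤ =
    subst (_≤ b) (shift (get xs (suc i)) (suc i) a) (bound (suc (suc i)) (s≤s z≤n) (s≤s i≤))

energy-suc : ∀ λs {p} i → period λs ≡ suc p → i ≤ p →
  energy λs (+ suc i) ≡ get λs (suc i) + i
energy-suc λs i per i≤p rewrite per | m<n⇒m%n≡m (s≤s i≤p) = refl

-- e_0 is read off the last index of the period: (0 - 1) mod (p + 1) = p.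
energy-zero : ∀ λs {p} → period λs ≡ suc p → energy λs (+ 0) ≡ get λs (suc p) + p
energy-zero λs {zero}  per rewrite per = refl
energy-zero λs {suc p} per rewrite per | m<n⇒m%n≡m {m = 1} (s≤s (s≤s (z≤n {p}))) = refl

module _ {n} (λs : List ℕ) (len : ℓ λs ≡ suc n) (mono : Monotone (suc n) λs) where

  private
    λ₁ = get λs 1
    step = proj₂ mono
    open ≤-Reasoning

  get+i≤-λ₁≤ℓ : λ₁ ≤ suc n → ∀ i → 1 ≤ i → i ≤ suc n → get λs i + i ≤ 3 + n
  get+i≤-λ₁≤ℓ λ₁≤ (suc zero)    _ _ = ≤-trans (≤-reflexive (+-comm λ₁ 1)) (m≤n⇒m≤1+n (s≤s λ₁≤))
  get+i≤-λ₁≤ℓ λ₁≤ (suc (suc j)) _ i≤ = begin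
    get λs (2 + j) + (2 + j)         ≡⟨ +-suc _ (suc j) ⟩
    suc (get λs (2 + j) + suc j)     ≡⟨ cong suc (energy-suc λs (suc j) per (≤-pred i≤)) ⟨
    suc (energy λs (+ (2 + j)))      ≤⟨ s≤s (step (+ 1) (suc j) (s≤s z≤n) (m≤n⇒m≤1+n (≤-pred i≤))) ⟩
    suc (suc (energy λs (+ 1)))      ≡⟨ cong (λ e → 2 + e) (energy-suc λs 0 per z≤n) ⟩
    suc (suc (λ₁ + 0))               ≤⟨ s≤s (s≤s (≤-trans (≤-reflexive (+-identityʳ λ₁)) λ₁≤)) ⟩
    3 + n                            ∎
    where
    per : period λs ≡ suc n
    per = trans (cong (λ₁ ⊔_) len) (m≤n⇒m⊔n≡n λ₁≤)

  get+i≤-λ₁≡1+ℓ : λ₁ ≡ 2 + n → ∀ i → 1 ≤ i → i ≤ suc n → get λs i + i ≤ 3 + n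
  get+i≤-λ₁≡1+ℓ λ₁≡ (suc j) _ i≤ = begin
    get λs (suc j) + suc j           ≡⟨ +-suc _ j ⟩
    suc (get λs (suc j) + j)         ≡⟨ cong suc (energy-suc λs j per (m≤n⇒m≤1+n (≤-pred i≤))) ⟨
    suc (energy λs (+ suc j))        ≤⟨ s≤s (step (+ 0) (suc j) (s≤s z≤n) i≤) ⟩
    suc (suc (energy λs (+ 0)))      ≡⟨ cong (λ e → 2 + e) (energy-zero λs per) ⟩
    suc (suc (get λs (2 + n) + suc n)) ≡⟨ cong (λ g → 2 + (g + suc n)) beyond ⟩
    3 + n                            ∎
    where
    per : period λs ≡ 2 + n
    per = trans (cong (λ₁ ⊔_) len) (trans (m≥n⇒m⊔n≡m (≤-trans (n≤1+n _) (≤-reflexive (sym λ₁≡)))) λ₁≡)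
    beyond : get λs (2 + n) ≡ 0
    beyond = length<⇒get≡0 λs (2 + n) (≤-reflexive (cong suc len))

  get+i≤ : ∀ i → 1 ≤ i → i ≤ suc n → get λs i + i ≤ 3 + n
  get+i≤ with λ₁ ≤? suc n
  ... | yes λ₁≤ = get+i≤-λ₁≤ℓ λ₁≤
  ... | no  λ₁≰ = get+i≤-λ₁≡1+ℓ (≤-antisym (subst (λ l → λ₁ ≤ suc l) len (proj₁ mono)) (≰⇒> λ₁≰))

  mass<T : mass λs < T (2 + n)
  mass<T = m*2≤n⇒m≤n/2 {n = (2 + n) * (3 + n)} (+-cancelʳ-≤ (suc n * (2 + n)) _ _ (begin
    suc (sum λs) * 2 + suc n * (2 + n)                            ≡⟨ lhs (sum λs) n ⟩
    2 + (2 * sum λs + suc n * (2 + n) + 2 * suc n * 0)            ≤⟨ +-monoʳ-≤ 2 staircase ⟩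
    2 + 2 * suc n * (3 + n)                                       ≡⟨ rhs n ⟩
    (2 + n) * (3 + n) + suc n * (2 + n)                           ∎))
    where
    lhs : ∀ S n → suc S * 2 + suc n * (2 + n) ≡ 2 + (2 * S + suc n * (2 + n) + 2 * suc n * 0)
    lhs = solve-∀
    rhs : ∀ n → 2 + 2 * suc n * (3 + n) ≡ (2 + n) * (3 + n) + suc n * (2 + n)
    rhs = solve-∀
    staircase : 2 * sum λs + suc n * (2 + n) + 2 * suc n * 0 ≤ 2 * suc n * (3 + n)
    staircase = subst (λ l → 2 * sum λs + l * suc l + 2 * l * 0 ≤ 2 * l * (3 + n)) len
      (sum+staircase≤ λs 0 (3 + n) λ i 1≤i i≤ →
        ≤-trans (≤-reflexive (+-identityʳ _)) (get+i≤ i 1≤i (subst (i ≤_) len i≤)))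

mainTheorem5 : (q : ℕ) → 2 ≤ q → (λs : List ℕ) → Config λs →
    Canonical q λs → ¬ Monotone (q ∸ 1) λs
mainTheorem5 (suc zero) (s≤s ()) _ _ _ _
mainTheorem5 (suc (suc n)) _ λs _ (T≤mass , _ , len , _) mono =
  <⇒≱ (mass<T λs len mono) T≤mass
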